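{- Let $x\in\mathcal S$ and let $\varepsilon>0$ be smaller than every nonzero value among $x(e)$ and $b(e)-x(e)$ ($e\in E$), and smaller than $x(e)-x(e')$ for all $w\in W^=$, $e\in H_w(x)$, $e'\in\pi^c_w(x)\setminus H_w(x)$. Let $x'\in\mathcal S$ satisfy $x'\prec_F x$ and $|x'-x|=\varepsilon$. If $w\in W^=$ and $x'_w\ne x_w$, then $\pi^c_w(x')=\pi^c_w(x)$, $H_w(x')=H_w(x)$, and $H_w(x)=\{e\in E_w: x'(e)<x(e)\}$.
   Context: Setting. $G=(V,E)$ finite bipartite with classes $F,W$; edges $fw$; capacities $b>0$ on $E$, quotas $q>0$ on $V$; for $v\in V$, $E_v$ = edges at $v$, weakly ordered by an ordered partition $\Pi_v=(\pi^1,\dots,\pi^k)$ into ties ($\pi^i$ better than $\pi^j$ if $i<j$). $a(S)=\sum_{e\in S}a(e)$, $|a|=\sum_e|a(e)|$, $a_v=a|_{E_v}$. Assignment: $0\le x\le b$, $x(E_v)\le q(v)$. If $x(E_v)=q(v)$ ($v$ fully filled): critical tie $\pi^c_v(x)$ = tie $\pi^i$ with $x(\pi^1\cup\dots\cup\pi^{i-1})<q(v)\le x(\pi^1\cup\dots\cup\pi^i)$; head $H_v(x)$ = edges of $\pi^c_v(x)$ of maximal $x$-value in it; tail $T_v(x)$ = edges of better ties plus $\pi^c_v(x)\setminus H_v(x)$. If $x(E_v)<q(v)$: $H_v=\emptyset$, $T_v=E_v$. Stable: no $fw$ with $x(fw)<b(fw)$, $fw\in T_f(x)\cap T_w(x)$;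 $\mathcal S$ = stable assignments. Preferences: $C_v(z)=z$ if $z(E_v)\le q(v)$, otherwise keep $z$ on ties better than the tie $\pi^i$ with $z(\pi^1\cup\dots\cup\pi^{i-1})<q(v)\le z(\pi^1\cup\dots\cup\pi^i)$, put $0$ on worse ties and $\min\{r,z(e)\}$ on $\pi^i$ with $r$ making the total $q(v)$; $z\succeq_v z'$ iff $C_v(z\vee z')=z$; for $x,y\in\mathcal S$, $x\succeq_F y$ iff $x_f\succeq_f y_f$ for all $f\in F$, and $x\succ_F y$ iff moreover $x\ne y$ ($\prec_F$ is the reverse). Known: the set of fully filled vertices is the same for all stable assignments; $W^=$ denotes the set of vertices of $W$ fully filled by $x$.
   Formalization: The capacities $b$, the quotas $q$, the assignments $x$ and $x'$, and $\varepsilon$ take values in the rationals instead of the reals. -}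

module Defs where

open import Data.Nat using (ℕ; zero; suc; _<ᵇ_; _≡ᵇ_)
import Data.Nat as ℕ
open import Data.Fin using (Fin; zero; suc)
import Data.Fin as Fin
open import Data.Bool using (Bool; true; false; if_then_else_)
open import Data.Rational using (ℚ; 0ℚ; _+_; _-_; _≤_; _<_; _⊔_; _⊓_)
open import Data.Product using (Σ; _×_; _,_)
open import Data.Sum using (_⊎_)
open import Relation.Nullary using (¬_)
open import Relation.Nullary.Decidable using (⌊_⌋)
open import Relation.Binary.PropositionalEquality using (_≡_)

sumFin : ∀ {m} → (Fin m → ℚ) → ℚ
sumFin {zero}  f = 0ℚ
sumFin {suc m} f = f zero + sumFin (λ e → f (suc e))

sumOn : ∀ {m} → (Fin m → Bool) → (Fin m → ℚ) → ℚ
sumOn P z = sumFin (λ e → if P e then z e else 0ℚ)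

_∨ᶠ_ : ∀ {m} → (Fin m → ℚ) → (Fin m → ℚ) → (Fin m → ℚ)
(z ∨ᶠ z') e = z e ⊔ z' e

-- One side of the bipartite graph: vertices Fin n, each edge e has endpoint
-- end e on this side; rank e is the index of the tie of Π_{end e} containing e
-- (smaller rank = better tie); q are the quotas.
module Side {m n : ℕ} (end : Fin m → Fin n) (rank : Fin m → ℕ) (q : Fin n → ℚ) where

  atᵇ : Fin n → Fin m → Bool
  atᵇ v e = ⌊ end e Fin.≟ v ⌋

  load : (Fin m → ℚ) → Fin n → ℚ
  load z v = sumOn (atᵇ v) z

  -- z(π^1 ∪ … ∪ π^{i-1}) at v  (ties strictly better than tie i)
  below : (Fin m → ℚ) → Fin n → ℕ → ℚ
  below z v i = sumOn (λ e → if atᵇ v e then rank e <ᵇ i else false) z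

  upto : (Fin m → ℚ) → Fin n → ℕ → ℚ
  upto z v i = sumOn (λ e → if atᵇ v e then rank e <ᵇ suc i else false) z

  Full : (Fin m → ℚ) → Fin n → Set
  Full z v = load z v ≡ q v

  IsCrit : (Fin m → ℚ) → Fin n → ℕ → Set
  IsCrit z v i = (below z v i < q v) × (q v ≤ upto z v i)

  -- e ∈ π^c_v(z)  (only defined when v is fully filled)
  InCritTie : (Fin m → ℚ) → Fin n → Fin m → Set
  InCritTie z v e = Full z v × (end e ≡ v) × Σ ℕ (λ i → IsCrit z v i × (rank e ≡ i))

  InHead : (Fin m → ℚ) → Fin n → Fin m → Set
  InHead z v e = InCritTie z v e ×
    (∀ e' → end e' ≡ v → rank e' ≡ rank e → z e' ≤ z e)

  InTail : (Fin m → ℚ) → Fin n → Fin m → Set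
  InTail z v e = (end e ≡ v) ×
    ((¬ Full z v) ⊎
     (Full z v × Σ ℕ (λ i → IsCrit z v i ×
        ((rank e ℕ.< i) ⊎ ((rank e ≡ i) × ¬ InHead z v e)))))

  -- the truncation used in C_v: keep better ties, min r on tie i, 0 on worse ties
  cut : (Fin m → ℚ) → ℕ → ℚ → Fin m → ℚ
  cut z i r e =
    if rank e <ᵇ i then z e else (if rank e ≡ᵇ i then r ⊓ z e else 0ℚ)

  -- Chooses v z c :  C_v(z) = c  on E_v
  Chooses : Fin n → (Fin m → ℚ) → (Fin m → ℚ) → Set
  Chooses v z c =
    ((load z v ≤ q v) × (∀ e → end e ≡ v → c e ≡ z e)) ⊎
    ((q v < load z v) × Σ ℕ (λ i → IsCrit z v i × Σ ℚ (λ r →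
        (sumOn (atᵇ v) (cut z i r) ≡ q v) ×
        (∀ e → end e ≡ v → c e ≡ cut z i r e))))

  Pref : Fin n → (Fin m → ℚ) → (Fin m → ℚ) → Set
  Pref v z z' = Chooses v (z ∨ᶠ z') z

-- A problem instance: finite simple bipartite graph with classes F = Fin nF,
-- W = Fin nW and edges Fin m, edge e = fend e · wend e.
record Instance : Set where
  field
    nF nW m : ℕ
    fend : Fin m → Fin nF
    wend : Fin m → Fin nW
    simple : ∀ e e' → fend e ≡ fend e' → wend e ≡ wend e' → e ≡ e'
    rankF : Fin m → ℕ   -- tie index of e in Π_{fend e}
    rankW : Fin m → ℕ   -- tie index of e in Π_{wend e}
    b : Fin m → ℚ
    b-pos : ∀ e → 0ℚ < b e
    qF : Fin nF → ℚ
    qF-pos : ∀ f → 0ℚ < qF f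
    qW : Fin nW → ℚ
    qW-pos : ∀ w → 0ℚ < qW w

module Market (I : Instance) where
  open Instance I

  module SF = Side fend rankF qF
  module SW = Side wend rankW qW

  IsAssignment : (Fin m → ℚ) → Set
  IsAssignment x = (∀ e → (0ℚ ≤ x e) × (x e ≤ b e)) ×
                   (∀ f → SF.load x f ≤ qF f) × (∀ w → SW.load x w ≤ qW w)

  Stable : (Fin m → ℚ) → Set
  Stable x = IsAssignment x ×
    (∀ e → x e < b e → ¬ (SF.InTail x (fend e) e × SW.InTail x (wend e) e))

  PrefF : (Fin m → ℚ) → (Fin m → ℚ) → Set
  PrefF x y = ∀ f → SF.Pref f x y

  -- y ≺_F x  (i.e. x ≻_F y)
  StrictlyWorseF : (Fin m → ℚ) → (Fin m → ℚ) → Set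
  StrictlyWorseF y x = PrefF x y × ¬ (∀ e → x e ≡ y e)

-- Since x ⪰_F x', every edge e with x'(e) < x(e) lies in the tail of its firm under x'
-- (x is obtained from x ∨ x' by truncating at a tie, and such an edge could otherwise be
-- traded against an edge of the same tie that x' raises); stability of x' then keeps e out
-- of the tail of its worker. Hence firm loads can only drop and worker loads only rise from
-- x to x', so all worker loads agree. At a full worker w some edge e₀ drops; being positive
-- under x it is no worse than the critical tie of x, and not being in the tail under x' it
-- is no better than the critical tie of x'. Since |x' - x| = ε is below every positive value
-- of x, x' keeps the ties strictly better than the critical tie c of x below the quota, so c
-- is critical for x' as well and every dropping edge is a head edge of x'. Finally, the gap
-- of more than ε between head and non-head edges of x in c cannot be bridged by a total
-- change of ε, which forces H_w(x') = H_w(x) = {e ∈ E_w : x'(e) < x(e)}.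
module Submission where

open import Defs
open import Data.Nat using (ℕ)
open import Data.Fin using (Fin)
open import Data.Rational using (ℚ; 0ℚ; _-_; _<_; ∣_∣)
open import Data.Product using (Σ; _×_)
open import Relation.Nullary using (¬_)
open import Relation.Binary.PropositionalEquality using (_≡_; _≢_)
open import Function.Bundles using (_⇔_; mk⇔)

open import Data.Bool using (Bool; true; false; if_then_else_)
open import Data.Fin using (zero; suc)
import Data.Fin as Fin
open import Data.Fin.Properties using (any?)
open import Data.Nat using (zero; suc; _<ᵇ_; _≡ᵇ_)
import Data.Nat as ℕ
import Data.Nat.Properties as ℕ
open import Data.Product using (_,_; proj₁; proj₂; ∃)
open import Data.Rational using (_+_; _≤_; -_; _⊓_; _⊔_)
open import Data.Rational.Properties
open import Data.Rational.Solver using (module +-*-Solver)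
open import Data.Sum using (_⊎_; inj₁; inj₂)
open import Function using (_∘_)
open import Relation.Binary.Definitions using (tri<; tri≈; tri>)
open import Relation.Nullary using (Dec; yes; no; contradiction; _×-dec_)
open import Relation.Nullary.Decidable using (⌊_⌋; does; dec-true; dec-false)
open import Relation.Binary.PropositionalEquality using (refl; sym; trans; cong; cong₂; subst; subst₂; ≢-sym)

open +-*-Solver

<⇒≱ : ∀ {p q} → p < q → ¬ q ≤ p
<⇒≱ p<q q≤p = <-irrefl refl (<-≤-trans p<q q≤p)

q+[p-q]≡p : ∀ p q → q + (p - q) ≡ p
q+[p-q]≡p = solve 2 (λ p q → q :+ (p :- q) := p) refl

p≤∣p∣ : ∀ p → p ≤ ∣ p ∣
p≤∣p∣ p with ≤-total 0ℚ p
... | inj₁ 0≤p = ≤-reflexive (sym (0≤p⇒∣p∣≡p 0≤p))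
... | inj₂ p≤0 = ≤-trans p≤0 (0≤∣p∣ p)

p≤q+∣p-q∣ : ∀ p q → p ≤ q + ∣ p - q ∣
p≤q+∣p-q∣ p q = subst (_≤ q + ∣ p - q ∣) (q+[p-q]≡p p q) (+-monoʳ-≤ q (p≤∣p∣ (p - q)))

q≤p+∣p-q∣ : ∀ p q → q ≤ p + ∣ p - q ∣
q≤p+∣p-q∣ p q = subst (λ t → q ≤ p + t) ∣q-p∣≡∣p-q∣ (p≤q+∣p-q∣ q p)
  where
  ∣q-p∣≡∣p-q∣ : ∣ q - p ∣ ≡ ∣ p - q ∣
  ∣q-p∣≡∣p-q∣ = trans (cong ∣_∣ (sym (neg-sub p q))) (∣-p∣≡∣p∣ (p - q))
    where
    neg-sub : ∀ p q → - (p - q) ≡ q - p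
    neg-sub = solve 2 (λ p q → :- (p :- q) := q :- p) refl

r<p-q⇒q+r<p : ∀ {p q r} → r < p - q → q + r < p
r<p-q⇒q+r<p {p} {q} {r} r<p-q = subst (q + r <_) (q+[p-q]≡p p q) (+-monoʳ-< q r<p-q)

sumFin-cong : ∀ {m} {f g : Fin m → ℚ} → (∀ i → f i ≡ g i) → sumFin f ≡ sumFin g
sumFin-cong {zero}  f≗g = refl
sumFin-cong {suc m} f≗g = cong₂ _+_ (f≗g zero) (sumFin-cong (f≗g ∘ suc))

sumFin-0 : ∀ {m} → sumFin {m} (λ _ → 0ℚ) ≡ 0ℚ
sumFin-0 {zero}  = refl
sumFin-0 {suc m} = trans (+-identityˡ _) (sumFin-0 {m})

sumFin-mono : ∀ {m} {f g : Fin m → ℚ} → (∀ i → f i ≤ g i) → sumFin f ≤ sumFin g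
sumFin-mono {zero}  f≤g = ≤-refl
sumFin-mono {suc m} f≤g = +-mono-≤ (f≤g zero) (sumFin-mono (f≤g ∘ suc))

sumFin-mono-< : ∀ {m} {f g : Fin m → ℚ} → (∀ i → f i ≤ g i) → ∀ k → f k < g k →
                sumFin f < sumFin g
sumFin-mono-< f≤g zero    fk<gk = +-mono-<-≤ fk<gk (sumFin-mono (f≤g ∘ suc))
sumFin-mono-< f≤g (suc k) fk<gk = +-mono-≤-< (f≤g zero) (sumFin-mono-< (f≤g ∘ suc) k fk<gk)

sumFin-≤⇒≡ : ∀ {m} {f g : Fin m → ℚ} → (∀ i → f i ≤ g i) → sumFin g ≤ sumFin f →
             ∀ i → f i ≡ g i
sumFin-≤⇒≡ {f = f} {g} f≤g Σg≤Σf i with f i <? g i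
... | yes fi<gi = contradiction (<-≤-trans (sumFin-mono-< f≤g i fi<gi) Σg≤Σf) (<-irrefl refl)
... | no  fi≮gi = ≤-antisym (f≤g i) (≮⇒≥ fi≮gi)

sumFin-<⇒∃< : ∀ {m} {f g : Fin m → ℚ} → sumFin f < sumFin g → ∃ λ i → f i < g i
sumFin-<⇒∃< {zero} Σf<Σg = contradiction Σf<Σg (<-irrefl refl)
sumFin-<⇒∃< {suc m} {f} {g} Σf<Σg with f zero <? g zero
... | yes f0<g0 = zero , f0<g0
... | no  f0≮g0 with sumFin (f ∘ suc) <? sumFin (g ∘ suc)
...   | yes Σ<Σ = let (i , fi<gi) = sumFin-<⇒∃< Σ<Σ in suc i , fi<gi
...   | no  Σ≮Σ = contradiction (<-≤-trans Σf<Σg (+-mono-≤ (≮⇒≥ f0≮g0) (≮⇒≥ Σ≮Σ))) (<-irrefl refl)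

sumFin-gap : ∀ {m} {f g : Fin m → ℚ} {a} → (∀ i → f i ≤ g i) → ∀ k → f k + a ≤ g k →
             sumFin f + a ≤ sumFin g
sumFin-gap {f = f} {g} {a} f≤g zero f0+a≤g0 =
  subst (_≤ sumFin g) (exchange (f zero) _ a) (+-mono-≤ f0+a≤g0 (sumFin-mono (f≤g ∘ suc)))
  where
  exchange : ∀ p q r → (p + r) + q ≡ (p + q) + r
  exchange = solve 3 (λ p q r → (p :+ r) :+ q := (p :+ q) :+ r) refl
sumFin-gap {f = f} {g} {a} f≤g (suc k) fk+a≤gk =
  subst (_≤ sumFin g) (sym (+-assoc (f zero) _ a)) (+-mono-≤ (f≤g zero) (sumFin-gap (f≤g ∘ suc) k fk+a≤gk))

0≤sumFin : ∀ {m} {f : Fin m → ℚ} → (∀ i → 0ℚ ≤ f i) → 0ℚ ≤ sumFin f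
0≤sumFin {m} {f} 0≤f = subst (_≤ sumFin f) (sumFin-0 {m}) (sumFin-mono 0≤f)

≤sumFin : ∀ {m} {f : Fin m → ℚ} → (∀ i → 0ℚ ≤ f i) → ∀ k → f k ≤ sumFin f
≤sumFin {f = f} 0≤f zero    = begin
  f zero                      ≡⟨ +-identityʳ (f zero) ⟨
  f zero + 0ℚ                 ≤⟨ +-monoʳ-≤ (f zero) (0≤sumFin (0≤f ∘ suc)) ⟩
  f zero + sumFin (f ∘ suc)   ∎
  where open ≤-Reasoning
≤sumFin {f = f} 0≤f (suc k) = begin
  f (suc k)                   ≤⟨ ≤sumFin (0≤f ∘ suc) k ⟩
  sumFin (f ∘ suc)            ≡⟨ +-identityˡ _ ⟨
  0ℚ + sumFin (f ∘ suc)       ≤⟨ +-monoˡ-≤ (sumFin (f ∘ suc)) (0≤f zero) ⟩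
  f zero + sumFin (f ∘ suc)   ∎
  where open ≤-Reasoning

+≤sumFin : ∀ {m} {f : Fin m → ℚ} → (∀ i → 0ℚ ≤ f i) → ∀ {k l} → k ≢ l → f k + f l ≤ sumFin f
+≤sumFin 0≤f {zero}  {zero}  0≢0 = contradiction refl 0≢0
+≤sumFin {f = f} 0≤f {zero}  {suc l} _ = +-monoʳ-≤ (f zero) (≤sumFin (0≤f ∘ suc) l)
+≤sumFin {f = f} 0≤f {suc k} {zero}  _ =
  subst (_≤ sumFin f) (+-comm (f zero) (f (suc k))) (+-monoʳ-≤ (f zero) (≤sumFin (0≤f ∘ suc) k))
+≤sumFin {f = f} 0≤f {suc k} {suc l} k≢l = begin
  f (suc k) + f (suc l)       ≤⟨ +≤sumFin (0≤f ∘ suc) (k≢l ∘ cong suc) ⟩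
  sumFin (f ∘ suc)            ≡⟨ +-identityˡ _ ⟨
  0ℚ + sumFin (f ∘ suc)       ≤⟨ +-monoˡ-≤ (sumFin (f ∘ suc)) (0≤f zero) ⟩
  f zero + sumFin (f ∘ suc)   ∎
  where open ≤-Reasoning

sumFin-+ : ∀ {m} (f g : Fin m → ℚ) → sumFin (λ i → f i + g i) ≡ sumFin f + sumFin g
sumFin-+ {zero}  f g = sym (+-identityʳ 0ℚ)
sumFin-+ {suc m} f g =
  trans (cong (f zero + g zero +_) (sumFin-+ (f ∘ suc) (g ∘ suc))) (medial (f zero) (g zero) _ _)
  where
  medial : ∀ a b c d → (a + b) + (c + d) ≡ (a + c) + (b + d)
  medial = solve 4 (λ a b c d → (a :+ b) :+ (c :+ d) := (a :+ c) :+ (b :+ d)) refl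

sumFin-comm : ∀ {n m} (f : Fin n → Fin m → ℚ) →
              sumFin (λ v → sumFin (f v)) ≡ sumFin (λ e → sumFin (λ v → f v e))
sumFin-comm {zero}  {m} f = sym (sumFin-0 {m})
sumFin-comm {suc n} f =
  trans (cong (sumFin (f zero) +_) (sumFin-comm (f ∘ suc))) (sym (sumFin-+ (f zero) _))

sumFin-indicator : ∀ {n} (k : Fin n) (a : ℚ) →
                   sumFin (λ v → if ⌊ k Fin.≟ v ⌋ then a else 0ℚ) ≡ a
sumFin-indicator {suc n} zero    a = trans (cong (a +_) (sumFin-0 {n})) (+-identityʳ a)
sumFin-indicator {suc n} (suc k) a =
  trans (+-identityˡ _) (trans (sumFin-cong summand) (sumFin-indicator k a))
  where
  summand : ∀ v → (if ⌊ suc k Fin.≟ suc v ⌋ then a else 0ℚ) ≡ (if ⌊ k Fin.≟ v ⌋ then a else 0ℚ)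
  summand v with k Fin.≟ v
  ... | yes _ = refl
  ... | no  _ = refl

sumFin-fibres : ∀ {m n} (end : Fin m → Fin n) (z : Fin m → ℚ) →
  sumFin (λ v → sumFin (λ e → if ⌊ end e Fin.≟ v ⌋ then z e else 0ℚ)) ≡ sumFin z
sumFin-fibres end z =
  trans (sumFin-comm (λ v e → if ⌊ end e Fin.≟ v ⌋ then z e else 0ℚ))
        (sumFin-cong (λ e → sumFin-indicator (end e) (z e)))

-- On ℕ, _<?_ and _≟_ are implemented by _<ᵇ_ and _≡ᵇ_, so `does` of these decisions
-- is definitionally the Boolean test used in Defs.
<ᵇ-true : ∀ {m n} → m ℕ.< n → (m <ᵇ n) ≡ true
<ᵇ-true {m} {n} = dec-true (m ℕ.<? n)

<ᵇ-false : ∀ {m n} → ¬ m ℕ.< n → (m <ᵇ n) ≡ false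
<ᵇ-false {m} {n} = dec-false (m ℕ.<? n)

≡ᵇ-true : ∀ {m n} → m ≡ n → (m ≡ᵇ n) ≡ true
≡ᵇ-true {m} {n} = dec-true (m ℕ.≟ n)

≡ᵇ-false : ∀ {m n} → m ≢ n → (m ≡ᵇ n) ≡ false
≡ᵇ-false {m} {n} = dec-false (m ℕ.≟ n)

dec-true⁻¹ : ∀ {a} {A : Set a} (a? : Dec A) → does a? ≡ true → A
dec-true⁻¹ (yes a) _ = a

dec-false⁻¹ : ∀ {a} {A : Set a} (a? : Dec A) → does a? ≡ false → ¬ A
dec-false⁻¹ (no ¬a) _ = ¬a

module _ {m : ℕ} where

  NonNegative : (Fin m → ℚ) → Set
  NonNegative z = ∀ e → 0ℚ ≤ z e

  _⊆ᵇ_ : (Fin m → Bool) → (Fin m → Bool) → Set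
  P ⊆ᵇ Q = ∀ e → P e ≡ true → Q e ≡ true

  restrict : (Fin m → Bool) → (Fin m → ℚ) → Fin m → ℚ
  restrict P z e = if P e then z e else 0ℚ

  restrict-true : ∀ (P : Fin m → Bool) {e} (z : Fin m → ℚ) → P e ≡ true → restrict P z e ≡ z e
  restrict-true P z Pe rewrite Pe = refl

  restrict-false : ∀ (P : Fin m → Bool) {e} (z : Fin m → ℚ) → P e ≡ false → restrict P z e ≡ 0ℚ
  restrict-false P z Pe rewrite Pe = refl

  restrict-cong : ∀ (P : Fin m → Bool) {y z : Fin m → ℚ} → (∀ e → P e ≡ true → y e ≡ z e) →
                  ∀ e → restrict P y e ≡ restrict P z e
  restrict-cong P y≗z e with P e in Pe
  ... | true  = y≗z e Pe
  ... | false = refl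

  restrict-mono : ∀ (P : Fin m → Bool) {y z : Fin m → ℚ} → (∀ e → P e ≡ true → y e ≤ z e) →
                  ∀ e → restrict P y e ≤ restrict P z e
  restrict-mono P y≤z e with P e in Pe
  ... | true  = y≤z e Pe
  ... | false = ≤-refl

  restrict-⊆ : ∀ {P Q : Fin m → Bool} {z : Fin m → ℚ} → NonNegative z → P ⊆ᵇ Q →
               ∀ e → restrict P z e ≤ restrict Q z e
  restrict-⊆ {P} {Q} 0≤z P⊆Q e with P e in Pe | Q e in Qe
  ... | true  | true  = ≤-refl
  ... | true  | false = contradiction (trans (sym (P⊆Q e Pe)) Qe) λ ()
  ... | false | true  = 0≤z e
  ... | false | false = ≤-refl

  sumOn-cong : ∀ (P : Fin m → Bool) {y z : Fin m → ℚ} → (∀ e → P e ≡ true → y e ≡ z e) →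
               sumOn P y ≡ sumOn P z
  sumOn-cong P y≗z = sumFin-cong (restrict-cong P y≗z)

  sumOn-congˡ : ∀ {P Q : Fin m → Bool} (z : Fin m → ℚ) → (∀ e → P e ≡ Q e) → sumOn P z ≡ sumOn Q z
  sumOn-congˡ z P≗Q = sumFin-cong (λ e → cong (λ b → if b then z e else 0ℚ) (P≗Q e))

  sumOn-none : ∀ {P : Fin m → Bool} (z : Fin m → ℚ) → (∀ e → P e ≡ false) → sumOn P z ≡ 0ℚ
  sumOn-none {P} z P≗false = trans (sumFin-cong (λ e → restrict-false P z (P≗false e))) (sumFin-0 {m})

  sumOn-mono : ∀ (P : Fin m → Bool) {y z : Fin m → ℚ} → (∀ e → P e ≡ true → y e ≤ z e) →
               sumOn P y ≤ sumOn P z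
  sumOn-mono P y≤z = sumFin-mono (restrict-mono P y≤z)

  sumOn-≤⇒≡ : ∀ (P : Fin m → Bool) {y z : Fin m → ℚ} → (∀ e → P e ≡ true → y e ≤ z e) →
              sumOn P z ≤ sumOn P y → ∀ e → P e ≡ true → y e ≡ z e
  sumOn-≤⇒≡ P {y} {z} y≤z Σz≤Σy e Pe =
    subst₂ _≡_ (restrict-true P y Pe) (restrict-true P z Pe) (sumFin-≤⇒≡ (restrict-mono P y≤z) Σz≤Σy e)

  sumOn-⊆ : ∀ {P Q : Fin m → Bool} {z : Fin m → ℚ} → NonNegative z → P ⊆ᵇ Q →
            sumOn P z ≤ sumOn Q z
  sumOn-⊆ 0≤z P⊆Q = sumFin-mono (restrict-⊆ 0≤z P⊆Q)

  sumOn-⊆-gap : ∀ {P Q : Fin m → Bool} {z : Fin m → ℚ} → NonNegative z → P ⊆ᵇ Q →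
                ∀ {e} → P e ≡ false → Q e ≡ true → sumOn P z + z e ≤ sumOn Q z
  sumOn-⊆-gap {P} {Q} {z} 0≤z P⊆Q {e} Pe Qe = sumFin-gap (restrict-⊆ 0≤z P⊆Q) e
    (≤-reflexive (trans (cong (_+ z e) (restrict-false P z Pe)) (trans (+-identityˡ (z e)) (sym (restrict-true Q z Qe)))))

  sumOn-<⇒∃ : ∀ {P Q : Fin m → Bool} {z : Fin m → ℚ} → NonNegative z → sumOn P z < sumOn Q z →
              ∃ λ e → P e ≡ false × Q e ≡ true × 0ℚ < z e
  sumOn-<⇒∃ {P} {Q} {z} 0≤z ΣP<ΣQ = let (e , lt) = sumFin-<⇒∃< ΣP<ΣQ in e , difference e lt
    where
    difference : ∀ e → restrict P z e < restrict Q z e → P e ≡ false × Q e ≡ true × 0ℚ < z e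
    difference e lt with P e | Q e
    ... | true  | true  = contradiction lt (<-irrefl refl)
    ... | true  | false = contradiction (<-≤-trans lt (0≤z e)) (<-irrefl refl)
    ... | false | true  = refl , refl , lt
    ... | false | false = contradiction lt (<-irrefl refl)

  sumOn-≤+dist : ∀ (P : Fin m → Bool) (y z : Fin m → ℚ) →
                 sumOn P y ≤ sumOn P z + sumFin (λ e → ∣ y e - z e ∣)
  sumOn-≤+dist P y z = ≤-trans (sumFin-mono summand) (≤-reflexive (sumFin-+ (restrict P z) _))
    where
    summand : ∀ e → restrict P y e ≤ restrict P z e + ∣ y e - z e ∣
    summand e with P e
    ... | true  = p≤q+∣p-q∣ (y e) (z e)
    ... | false = ≤-trans (0≤∣p∣ (y e - z e)) (≤-reflexive (sym (+-identityˡ _)))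

maxFin : ∀ {k} → (Fin k → ℕ) → ℕ
maxFin {zero}  r = 0
maxFin {suc k} r = r zero ℕ.⊔ maxFin (r ∘ suc)

≤maxFin : ∀ {k} (r : Fin k → ℕ) (i : Fin k) → r i ℕ.≤ maxFin r
≤maxFin r zero    = ℕ.m≤m⊔n _ _
≤maxFin r (suc i) = ℕ.m≤n⇒m≤o⊔n (r zero) (≤maxFin (r ∘ suc) i)

crossing : (g : ℕ → ℚ) {a : ℚ} → g 0 < a → ∀ R → a ≤ g (suc R) →
           ∃ λ i → g i < a × a ≤ g (suc i)
crossing g g0<a zero    a≤g1 = 0 , g0<a , a≤g1
crossing g {a} g0<a (suc R) a≤g[2+R] with a ≤? g (suc R)
... | yes a≤g[1+R] = crossing g g0<a R a≤g[1+R]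
... | no  a≰g[1+R] = suc R , ≰⇒> a≰g[1+R] , a≤g[2+R]

maximum-or-empty : ∀ {k} {P : Fin k → Set} → (∀ i → Dec (P i)) → (g : Fin k → ℚ) →
                   (∀ i → ¬ P i) ⊎ (∃ λ h → P h × ∀ i → P i → g i ≤ g h)
maximum-or-empty {zero} P? g = inj₁ λ ()
maximum-or-empty {suc k} P? g with P? zero | maximum-or-empty (P? ∘ suc) (g ∘ suc)
... | no ¬P0 | inj₁ ¬P = inj₁ λ { zero → ¬P0 ; (suc i) → ¬P i }
... | no ¬P0 | inj₂ (h , Ph , max) =
  inj₂ (suc h , Ph , λ { zero P0 → contradiction P0 ¬P0 ; (suc i) Pi → max i Pi })
... | yes P0 | inj₁ ¬P = inj₂ (zero , P0 , λ { zero _ → ≤-refl ; (suc i) Pi → contradiction Pi (¬P i) })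
... | yes P0 | inj₂ (h , Ph , max) with g (suc h) ≤? g zero
...   | yes gh≤g0 = inj₂ (zero , P0 , λ { zero _ → ≤-refl ; (suc i) Pi → ≤-trans (max i Pi) gh≤g0 })
...   | no  gh≰g0 = inj₂ (suc h , Ph , λ { zero _ → <⇒≤ (≰⇒> gh≰g0) ; (suc i) Pi → max i Pi })

argmax : ∀ {k} {P : Fin k → Set} → (∀ i → Dec (P i)) → (g : Fin k → ℚ) → ∃ P →
         ∃ λ h → P h × ∀ i → P i → g i ≤ g h
argmax P? g (i , Pi) with maximum-or-empty P? g
... | inj₁ ¬P  = contradiction Pi (¬P i)
... | inj₂ max = max

module SideProperties {m n : ℕ} (end : Fin m → Fin n) (rank : Fin m → ℕ) (q : Fin n → ℚ) where
  open Side end rank q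

  belowᵇ : Fin n → ℕ → Fin m → Bool
  belowᵇ v i e = if atᵇ v e then rank e <ᵇ i else false

  atᵇ-true : ∀ {v e} → end e ≡ v → atᵇ v e ≡ true
  atᵇ-true {v} {e} ev with end e Fin.≟ v
  ... | yes _  = refl
  ... | no  ¬ev = contradiction ev ¬ev

  atᵇ-true⁻¹ : ∀ {v e} → atᵇ v e ≡ true → end e ≡ v
  atᵇ-true⁻¹ {v} {e} eq with end e Fin.≟ v
  ... | yes ev = ev

  belowᵇ-true : ∀ {v i e} → end e ≡ v → rank e ℕ.< i → belowᵇ v i e ≡ true
  belowᵇ-true ev r<i rewrite atᵇ-true ev = <ᵇ-true r<i

  belowᵇ-true⁻¹ : ∀ {v i e} → belowᵇ v i e ≡ true → end e ≡ v × rank e ℕ.< i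
  belowᵇ-true⁻¹ {v} {i} {e} eq with atᵇ v e in ev
  ... | true = atᵇ-true⁻¹ ev , dec-true⁻¹ (rank e ℕ.<? i) eq

  belowᵇ-false : ∀ {v i e} → ¬ rank e ℕ.< i → belowᵇ v i e ≡ false
  belowᵇ-false {v} {i} {e} r≮i with atᵇ v e
  ... | true  = <ᵇ-false r≮i
  ... | false = refl

  belowᵇ-false⁻¹ : ∀ {v i e} → end e ≡ v → belowᵇ v i e ≡ false → ¬ rank e ℕ.< i
  belowᵇ-false⁻¹ {v} {i} {e} ev eq rewrite atᵇ-true ev = dec-false⁻¹ (rank e ℕ.<? i) eq

  belowᵇ-mono : ∀ {v i j} → i ℕ.≤ j → belowᵇ v i ⊆ᵇ belowᵇ v j
  belowᵇ-mono {v} {i} i≤j e eq = let (ev , r<i) = belowᵇ-true⁻¹ {v} {i} eq in belowᵇ-true ev (ℕ.<-≤-trans r<i i≤j)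

  belowᵇ⊆atᵇ : ∀ {v i} → belowᵇ v i ⊆ᵇ atᵇ v
  belowᵇ⊆atᵇ {v} {i} e eq = atᵇ-true (proj₁ (belowᵇ-true⁻¹ {v} {i} eq))

  below-mono : ∀ {z} → NonNegative z → ∀ {v i j} → i ℕ.≤ j → below z v i ≤ below z v j
  below-mono 0≤z {v} {i} i≤j = sumOn-⊆ 0≤z (belowᵇ-mono {v} {i} i≤j)

  below≤load : ∀ {z} → NonNegative z → ∀ {v} i → below z v i ≤ load z v
  below≤load 0≤z {v} i = sumOn-⊆ 0≤z (belowᵇ⊆atᵇ {v} {i})

  IsCrit-unique : ∀ {z v i j} → NonNegative z → IsCrit z v i → IsCrit z v j → i ≡ j
  IsCrit-unique {i = i} {j} 0≤z (bi<q , q≤ui) (bj<q , q≤uj) with ℕ.<-cmp i j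
  ... | tri< i<j _ _ = contradiction (≤-trans q≤ui (below-mono 0≤z i<j)) (<⇒≱ bj<q)
  ... | tri≈ _ i≡j _ = i≡j
  ... | tri> _ _ j<i = contradiction (≤-trans q≤uj (below-mono 0≤z j<i)) (<⇒≱ bi<q)

  IsCrit-exists : ∀ {z v} → Full z v → 0ℚ < q v → ∃ (IsCrit z v)
  IsCrit-exists {z} {v} full 0<q = crossing (below z v) below₀<q (maxFin rank) q≤below[1+max]
    where
    below₀<q : below z v 0 < q v
    below₀<q = subst (_< q v) (sym (sumOn-none z (λ _ → belowᵇ-false ℕ.n≮0))) 0<q
    q≤below[1+max] : q v ≤ below z v (suc (maxFin rank))
    q≤below[1+max] = ≤-reflexive (trans (sym full) (sumOn-congˡ z all-below))
      where
      all-below : ∀ e → atᵇ v e ≡ belowᵇ v (suc (maxFin rank)) e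
      all-below e with atᵇ v e
      ... | true  = sym (<ᵇ-true (ℕ.s≤s (≤maxFin rank e)))
      ... | false = refl

  positive⇒rank≤crit : ∀ {z v i e} → NonNegative z → load z v ≤ q v → q v ≤ upto z v i →
                       end e ≡ v → 0ℚ < z e → rank e ℕ.≤ i
  positive⇒rank≤crit {z} {v} {i} {e} 0≤z load≤q q≤upto ev 0<ze with rank e ℕ.≤? i
  ... | yes r≤i = r≤i
  ... | no  r≰i = contradiction (≤-trans gap (≤-trans load≤q q≤upto)) (<⇒≱ upto<upto+ze)
    where
    gap : upto z v i + z e ≤ load z v
    gap = sumOn-⊆-gap 0≤z (belowᵇ⊆atᵇ {v} {suc i}) (belowᵇ-false (r≰i ∘ ℕ.≤-pred)) (atᵇ-true ev)
    upto<upto+ze : upto z v i < upto z v i + z e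
    upto<upto+ze = subst (_< upto z v i + z e) (+-identityʳ _) (+-monoʳ-< (upto z v i) 0<ze)

  crit-tie-positive : ∀ {z v i} → NonNegative z → below z v i < upto z v i →
    ∃ λ e → end e ≡ v × rank e ≡ i × 0ℚ < z e × below z v i + z e ≤ upto z v i
  crit-tie-positive {z} {v} {i} 0≤z b<u =
    let (e , ∉below , ∈upto , 0<ze) = sumOn-<⇒∃ 0≤z b<u
        (ev , r<1+i) = belowᵇ-true⁻¹ {v} {suc i} ∈upto
        r≮i = belowᵇ-false⁻¹ {v} {i} ev ∉below
    in e , ev , ℕ.≤-antisym (ℕ.≤-pred r<1+i) (ℕ.≮⇒≥ r≮i) , 0<ze ,
       sumOn-⊆-gap 0≤z (belowᵇ-mono {v} {i} (ℕ.n≤1+n i)) ∉below ∈upto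

  ¬tail⇒full : ∀ {z v e} → end e ≡ v → ¬ InTail z v e → Full z v
  ¬tail⇒full {z} {v} ev ¬tail with load z v ≟ q v
  ... | yes full  = full
  ... | no  ¬full = contradiction (ev , inj₁ ¬full) ¬tail

  ¬tail⇒crit≤rank : ∀ {z v i e} → Full z v → IsCrit z v i → end e ≡ v → ¬ InTail z v e →
                    i ℕ.≤ rank e
  ¬tail⇒crit≤rank full crit ev ¬tail = ℕ.≮⇒≥ (λ r<i → ¬tail (ev , inj₂ (full , _ , crit , inj₁ r<i)))

  ¬tail⇒head : ∀ {z v i e} → Full z v → IsCrit z v i → end e ≡ v → rank e ≡ i → ¬ InTail z v e →
               InHead z v e
  ¬tail⇒head {z} {e = e} full crit ev r≡i ¬tail = (full , ev , _ , crit , r≡i) , maximal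
    where
    maximal : ∀ e' → end e' ≡ _ → rank e' ≡ rank e → z e' ≤ z e
    maximal e' e'v r'≡r = ≮⇒≥ λ ze<ze' →
      ¬tail (ev , inj₂ (full , _ , crit , inj₂ (r≡i , λ head → <⇒≱ ze<ze' (proj₂ head e' e'v r'≡r))))

  head-rank : ∀ {z v i e} → NonNegative z → InHead z v e → IsCrit z v i → rank e ≡ i
  head-rank 0≤z ((_ , _ , _ , critj , r≡j) , _) criti = trans r≡j (IsCrit-unique 0≤z critj criti)

  head-exists : ∀ {z v i e} → Full z v → IsCrit z v i → end e ≡ v → rank e ≡ i → ∃ (InHead z v)
  head-exists {z} {v} {i} {e} full crit ev r≡i =
    let (h , (hv , rh≡i) , max) = argmax (λ e → (end e Fin.≟ v) ×-dec (rank e ℕ.≟ i)) z (e , ev , r≡i)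
    in h , (full , hv , i , crit , rh≡i) , λ e' e'v r'≡rh → max e' (e'v , trans r'≡rh rh≡i)

  near-head⇒head : ∀ {z v h e ε} → NonNegative z → InHead z v h → InCritTie z v e →
                   (¬ InHead z v e → ε < z h - z e) → z h ≤ z e + ε → InHead z v e
  near-head⇒head {z} {v} {h} {e} 0≤z head-h@((_ , hv , _) , _) tie-e@(_ , _ , _ , crit , r≡i) gap zh≤ze+ε =
    tie-e , λ e' e'v r'≡r → ≤-trans (proj₂ head-h e' e'v (trans r'≡r r≡rh)) zh≤ze
    where
    r≡rh : rank e ≡ rank h
    r≡rh = trans r≡i (sym (head-rank 0≤z head-h crit))
    zh≤ze : z h ≤ z e
    zh≤ze = ≮⇒≥ λ ze<zh →
      <⇒≱ (r<p-q⇒q+r<p (gap (λ head-e → <⇒≱ ze<zh (proj₂ head-e h hv (sym r≡rh))))) zh≤ze+ε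

  sumFin-load : ∀ z → sumFin (load z) ≡ sumFin z
  sumFin-load = sumFin-fibres end

  exchange-edge : ∀ {z z' v e} → load z v ≤ load z' v → end e ≡ v → z' e < z e →
                  ∃ λ e' → end e' ≡ v × z e' < z' e'
  exchange-edge {z} {z'} {v} {e} Σz≤Σz' ev z'e<ze
    with any? (λ e' → (end e' Fin.≟ v) ×-dec (z e' <? z' e'))
  ... | yes found = found
  ... | no  none  = contradiction (sumOn-≤⇒≡ (atᵇ v) z'≤z Σz≤Σz' e (atᵇ-true ev)) (<⇒≢ z'e<ze)
    where
    z'≤z : ∀ e' → atᵇ v e' ≡ true → z' e' ≤ z e'
    z'≤z e' at = ≮⇒≥ λ ze'<z'e' → none (e' , atᵇ-true⁻¹ at , ze'<z'e')

  cut-< : ∀ {z i r e} → rank e ℕ.< i → cut z i r e ≡ z e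
  cut-< {i = i} {e = e} r<i rewrite <ᵇ-true r<i = refl

  cut-≡ : ∀ {z i r e} → rank e ≡ i → cut z i r e ≡ r ⊓ z e
  cut-≡ {i = i} {e = e} r≡i rewrite <ᵇ-false (ℕ.<-irrefl r≡i) | ≡ᵇ-true r≡i = refl

  cut-> : ∀ {z i r e} → i ℕ.< rank e → cut z i r e ≡ 0ℚ
  cut-> {i = i} {e = e} i<r rewrite <ᵇ-false (ℕ.<⇒≯ i<r) | ≡ᵇ-false (ℕ.>⇒≢ i<r) = refl

  cut-full : ∀ {c z i r v} → (∀ e → end e ≡ v → c e ≡ cut z i r e) →
             sumOn (atᵇ v) (cut z i r) ≡ q v → Full c v
  cut-full {v = v} c≗cut Σcut≡q = trans (sumOn-cong (atᵇ v) (λ e at → c≗cut e (atᵇ-true⁻¹ at))) Σcut≡q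

module MarketProperties (I : Instance) where
  open Instance I
  open Market I
  module FP = SideProperties fend rankF qF
  module WP = SideProperties wend rankW qW

  module Decrease {x x' : Fin m → ℚ} (x-asg : IsAssignment x) (x'-stable : Stable x')
                  (x⪰x' : PrefF x x') where

    0≤x : NonNegative x
    0≤x e = proj₁ (proj₁ x-asg e)

    0≤x' : NonNegative x'
    0≤x' e = proj₁ (proj₁ (proj₁ x'-stable) e)

    firm-load-≤ : ∀ f → SF.load x' f ≤ SF.load x f
    firm-load-≤ f with x⪰x' f
    ... | inj₁ (_ , x≡x∨x') = sumOn-mono (SF.atᵇ f) λ e at → p⊔q≡p⇒q≤p (sym (x≡x∨x' e (FP.atᵇ-true⁻¹ at)))
    ... | inj₂ (_ , i , _ , r , Σcut≡q , x≡cut) =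
      ≤-trans (proj₁ (proj₂ (proj₁ x'-stable)) f) (≤-reflexive (sym (FP.cut-full {i = i} {r} x≡cut Σcut≡q)))

    module Truncation {f i r} (x≡cut : ∀ e → fend e ≡ f → x e ≡ SF.cut (x ∨ᶠ x') i r e) where

      rank≤cut : ∀ {e} → fend e ≡ f → 0ℚ < x e → rankF e ℕ.≤ i
      rank≤cut {e} ef 0<xe =
        ℕ.≮⇒≥ λ i<r → <⇒≢ 0<xe (sym (trans (x≡cut e ef) (FP.cut-> {x ∨ᶠ x'} {i} {r} i<r)))

      x'≤x-above-cut : ∀ {e} → fend e ≡ f → rankF e ℕ.< i → x' e ≤ x e
      x'≤x-above-cut {e} ef r<i =
        ≤-trans (p≤q⊔p (x e) (x' e)) (≤-reflexive (sym (trans (x≡cut e ef) (FP.cut-< {x ∨ᶠ x'} {i} {r} r<i))))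

      x-at-cut : ∀ {e} → fend e ≡ f → rankF e ≡ i → x e ≡ r ⊓ (x e ⊔ x' e)
      x-at-cut {e} ef r≡i = trans (x≡cut e ef) (FP.cut-≡ {x ∨ᶠ x'} {i} {r} r≡i)

      ≤cut-level : ∀ {e} → fend e ≡ f → rankF e ≡ i → x e ≤ r
      ≤cut-level {e} ef r≡i = subst (_≤ r) (sym (x-at-cut ef r≡i)) (p⊓q≤p r _)

      increased⇒cut-level : ∀ {e} → fend e ≡ f → rankF e ≡ i → x e < x' e → x e ≡ r
      increased⇒cut-level {e} ef r≡i xe<x'e with ⊓-sel r (x e ⊔ x' e)
      ... | inj₁ min≡r = trans (x-at-cut ef r≡i) min≡r
      ... | inj₂ min≡z = contradiction (≤-trans (p≤q⊔p (x e) (x' e)) (≤-reflexive (sym (trans (x-at-cut ef r≡i) min≡z))))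
                                       (<⇒≱ xe<x'e)

      cut≤crit' : SF.IsCrit (x ∨ᶠ x') f i → ∀ {j} → SF.IsCrit x' f j → i ℕ.≤ j
      cut≤crit' crit {j} crit' = ℕ.≮⇒≥ λ j<i → <⇒≱ (proj₁ crit) (begin
        qF f                    ≤⟨ proj₂ crit' ⟩
        SF.upto x' f j          ≤⟨ FP.below-mono 0≤x' j<i ⟩
        SF.below x' f i         ≤⟨ sumOn-mono (FP.belowᵇ f i) (λ e _ → p≤q⊔p (x e) (x' e)) ⟩
        SF.below (x ∨ᶠ x') f i  ∎)
        where open ≤-Reasoning

    decreased⇒firm-tail : ∀ {e} → x' e < x e → ¬ ¬ SF.InTail x' (fend e) e
    decreased⇒firm-tail {e} x'e<xe ¬tail with x⪰x' (fend e)
    ... | inj₁ (_ , x≡x∨x') =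
      let (e' , e'f , xe'<x'e') = FP.exchange-edge x-load≤x'-load refl x'e<xe
      in <⇒≱ xe'<x'e' (p⊔q≡p⇒q≤p (sym (x≡x∨x' e' e'f)))
      where
      x-load≤x'-load : SF.load x (fend e) ≤ SF.load x' (fend e)
      x-load≤x'-load = ≤-trans (proj₁ (proj₂ x-asg) (fend e)) (≤-reflexive (sym (FP.¬tail⇒full refl ¬tail)))
    ... | inj₂ (_ , i , crit , r , Σcut≡q , x≡cut) =
      let (j , crit') = FP.IsCrit-exists full' (qF-pos (fend e))
          j≤r = FP.¬tail⇒crit≤rank full' crit' refl ¬tail
          r≤i = rank≤cut refl (≤-<-trans (0≤x' e) x'e<xe)
          i≤j = cut≤crit' crit crit'
          r≡i = ℕ.≤-antisym r≤i (ℕ.≤-trans i≤j j≤r)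
          head' = FP.¬tail⇒head full' crit' refl (ℕ.≤-antisym (ℕ.≤-trans r≤i i≤j) j≤r) ¬tail
          (e' , e'f , xe'<x'e') = FP.exchange-edge (≤-reflexive (trans x-full (sym full'))) refl x'e<xe
          r'≡i = ℕ.≤-antisym
            (ℕ.≤-trans (FP.positive⇒rank≤crit 0≤x' (≤-reflexive full') (proj₂ crit') e'f (≤-<-trans (0≤x e') xe'<x'e'))
                       (ℕ.≤-trans j≤r r≤i))
            (ℕ.≮⇒≥ λ r'<i → <⇒≱ xe'<x'e' (x'≤x-above-cut e'f r'<i))
          x'e<x'e' = begin-strict
            x' e   <⟨ x'e<xe ⟩
            x e    ≤⟨ ≤cut-level refl r≡i ⟩
            r      ≡⟨ increased⇒cut-level e'f r'≡i xe'<x'e' ⟨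
            x e'   <⟨ xe'<x'e' ⟩
            x' e'  ∎
      in <⇒≱ x'e<x'e' (proj₂ head' e' e'f (trans r'≡i (sym r≡i)))
      where
      open ≤-Reasoning
      open Truncation {i = i} {r} x≡cut
      full' : SF.Full x' (fend e)
      full' = FP.¬tail⇒full refl ¬tail
      x-full : SF.Full x (fend e)
      x-full = FP.cut-full {i = i} {r} x≡cut Σcut≡q

    decreased⇒¬worker-tail : ∀ {w e} → wend e ≡ w → x' e < x e → ¬ SW.InTail x' w e
    decreased⇒¬worker-tail {e = e} refl x'e<xe w-tail = decreased⇒firm-tail x'e<xe λ f-tail →
      proj₂ x'-stable e (<-≤-trans x'e<xe (proj₂ (proj₁ x-asg e))) (f-tail , w-tail)

    worker-load-≤ : ∀ w → SW.load x w ≤ SW.load x' w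
    worker-load-≤ w with SW.load x' w ≟ qW w
    ... | yes full' = ≤-trans (proj₂ (proj₂ x-asg) w) (≤-reflexive (sym full'))
    ... | no ¬full' = sumOn-mono (SW.atᵇ w) λ e at → ≮⇒≥ λ x'e<xe →
      decreased⇒¬worker-tail (WP.atᵇ-true⁻¹ at) x'e<xe (WP.atᵇ-true⁻¹ at , inj₁ ¬full')

    worker-load-≡ : ∀ w → SW.load x w ≡ SW.load x' w
    worker-load-≡ = sumFin-≤⇒≡ worker-load-≤ (begin
      sumFin (SW.load x')  ≡⟨ WP.sumFin-load x' ⟩
      sumFin x'            ≡⟨ FP.sumFin-load x' ⟨
      sumFin (SF.load x')  ≤⟨ sumFin-mono firm-load-≤ ⟩
      sumFin (SF.load x)   ≡⟨ FP.sumFin-load x ⟩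
      sumFin x             ≡⟨ WP.sumFin-load x ⟨
      sumFin (SW.load x)   ∎)
      where open ≤-Reasoning

    module AtFullWorker {w} (x-full : SW.Full x w) where

      Decreased : Fin m → Set
      Decreased e = wend e ≡ w × x' e < x e

      x'-full : SW.Full x' w
      x'-full = trans (sym (worker-load-≡ w)) x-full

      decreased-edge : ¬ (∀ e → wend e ≡ w → x' e ≡ x e) → ∃ Decreased
      decreased-edge x'≢x with any? (λ e → (wend e Fin.≟ w) ×-dec (x' e <? x e))
      ... | yes found = found
      ... | no  none  = contradiction x'≡x x'≢x
        where
        x≤x' : ∀ e → SW.atᵇ w e ≡ true → x e ≤ x' e
        x≤x' e at = ≮⇒≥ λ x'e<xe → none (e , WP.atᵇ-true⁻¹ at , x'e<xe)
        x'≡x : ∀ e → wend e ≡ w → x' e ≡ x e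
        x'≡x e ew = sym (sumOn-≤⇒≡ (SW.atᵇ w) x≤x' (≤-reflexive (sym (worker-load-≡ w))) e (WP.atᵇ-true ew))

      decreased⇒rank≤crit : ∀ {c e} → SW.IsCrit x w c → Decreased e → rankW e ℕ.≤ c
      decreased⇒rank≤crit crit (ew , x'e<xe) =
        WP.positive⇒rank≤crit 0≤x (≤-reflexive x-full) (proj₂ crit) ew (≤-<-trans (0≤x' _) x'e<xe)

      decreased⇒rank≡crit : ∀ {c e} → SW.IsCrit x w c → SW.IsCrit x' w c → Decreased e → rankW e ≡ c
      decreased⇒rank≡crit crit crit' dec@(ew , x'e<xe) = ℕ.≤-antisym (decreased⇒rank≤crit crit dec)
        (WP.¬tail⇒crit≤rank x'-full crit' ew (decreased⇒¬worker-tail ew x'e<xe))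

      decreased⇒head' : ∀ {c e} → SW.IsCrit x w c → SW.IsCrit x' w c → Decreased e → SW.InHead x' w e
      decreased⇒head' crit crit' dec@(ew , x'e<xe) =
        WP.¬tail⇒head x'-full crit' ew (decreased⇒rank≡crit crit crit' dec) (decreased⇒¬worker-tail ew x'e<xe)

      head⇒decreased : ∀ {c e₀ e} → SW.IsCrit x w c → SW.IsCrit x' w c → Decreased e₀ →
                       SW.InHead x w e → Decreased e
      head⇒decreased {c} {e₀} {e} crit crit' dec₀@(e₀w , x'e₀<xe₀) head-e@((_ , ew , _) , max) =
        ew , (begin-strict
          x' e   ≤⟨ proj₂ head'-e₀ e ew (trans (WP.head-rank 0≤x head-e crit) (sym r₀≡c)) ⟩
          x' e₀  <⟨ x'e₀<xe₀ ⟩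
          x e₀   ≤⟨ max e₀ e₀w (trans r₀≡c (sym (WP.head-rank 0≤x head-e crit))) ⟩
          x e    ∎)
        where
        open ≤-Reasoning
        head'-e₀ = decreased⇒head' crit crit' dec₀
        r₀≡c = decreased⇒rank≡crit crit crit' dec₀

      module Perturbation {ε} (ε<x : ∀ e → x e ≢ 0ℚ → ε < x e)
        (gap : ∀ e e' → SW.InHead x w e → SW.InCritTie x w e' → ¬ SW.InHead x w e' → ε < x e - x e')
        (Σdist≡ε : sumFin (λ e → ∣ x' e - x e ∣) ≡ ε) where

        dist : Fin m → ℚ
        dist e = ∣ x' e - x e ∣

        dist+dist≤ε : ∀ {e e'} → e ≢ e' → dist e + dist e' ≤ ε
        dist+dist≤ε e≢e' = subst (_ ≤_) Σdist≡ε (+≤sumFin (λ e → 0≤∣p∣ (x' e - x e)) e≢e')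

        crit-preserved : ∀ {c e} → SW.IsCrit x w c → Decreased e → SW.IsCrit x' w c
        crit-preserved {c} crit dec@(ew , x'e<xe) = below'<q , q≤upto'
          where
          below'<q : SW.below x' w c < qW w
          below'<q =
            let (e₁ , _ , _ , 0<xe₁ , below+xe₁≤upto) = WP.crit-tie-positive 0≤x (<-≤-trans (proj₁ crit) (proj₂ crit))
            in begin-strict
              SW.below x' w c                ≤⟨ sumOn-≤+dist (WP.belowᵇ w c) x' x ⟩
              SW.below x w c + sumFin dist   ≡⟨ cong (SW.below x w c +_) Σdist≡ε ⟩
              SW.below x w c + ε             <⟨ +-monoʳ-< (SW.below x w c) (ε<x e₁ (≢-sym (<⇒≢ 0<xe₁))) ⟩
              SW.below x w c + x e₁          ≤⟨ below+xe₁≤upto ⟩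
              SW.upto x w c                  ≤⟨ WP.below≤load 0≤x (suc c) ⟩
              SW.load x w                    ≡⟨ x-full ⟩
              qW w                           ∎
            where open ≤-Reasoning
          q≤upto' : qW w ≤ SW.upto x' w c
          q≤upto' =
            let (j , critj) = WP.IsCrit-exists x'-full (qW-pos w)
                j≤c = ℕ.≤-trans (WP.¬tail⇒crit≤rank x'-full critj ew (decreased⇒¬worker-tail ew x'e<xe))
                                (decreased⇒rank≤crit crit dec)
            in ≤-trans (proj₂ critj) (WP.below-mono 0≤x' (ℕ.s≤s j≤c))

        head'⇒head : ∀ {c h e} → SW.IsCrit x w c → SW.IsCrit x' w c → SW.InHead x w h →
                     SW.InHead x' w e → SW.InHead x w e
        head'⇒head {c} {h} {e} crit crit' head-h@((_ , hw , _) , _) head'-e@((_ , ew , _) , _) with e Fin.≟ h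
        ... | yes refl = head-h
        ... | no  e≢h  = WP.near-head⇒head 0≤x head-h tie-e (gap h e head-h tie-e) (begin
          x h                       ≤⟨ q≤p+∣p-q∣ (x' h) (x h) ⟩
          x' h + dist h             ≤⟨ +-monoˡ-≤ (dist h) (proj₂ head'-e h hw rh≡re) ⟩
          x' e + dist h             ≤⟨ +-monoˡ-≤ (dist h) (p≤q+∣p-q∣ (x' e) (x e)) ⟩
          (x e + dist e) + dist h   ≡⟨ +-assoc (x e) (dist e) (dist h) ⟩
          x e + (dist e + dist h)   ≤⟨ +-monoʳ-≤ (x e) (dist+dist≤ε e≢h) ⟩
          x e + ε                   ∎)
          where
          open ≤-Reasoning
          re≡c : rankW e ≡ c
          re≡c = WP.head-rank 0≤x' head'-e crit'
          rh≡re : rankW h ≡ rankW e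
          rh≡re = trans (WP.head-rank 0≤x head-h crit) (sym re≡c)
          tie-e : SW.InCritTie x w e
          tie-e = x-full , ew , c , crit , re≡c

lemma3 : (I : Instance) → let open Instance I in let open Market I in
    (x : Fin m → ℚ) → Stable x →
    (ε : ℚ) → 0ℚ < ε →
    (∀ e → x e ≢ 0ℚ → ε < x e) →
    (∀ e → b e - x e ≢ 0ℚ → ε < b e - x e) →
    (∀ w → SW.Full x w → ∀ e e' → SW.InHead x w e →
       SW.InCritTie x w e' → ¬ SW.InHead x w e' → ε < x e - x e') →
    (x' : Fin m → ℚ) → Stable x' → StrictlyWorseF x' x →
    sumFin (λ e → ∣ x' e - x e ∣) ≡ ε →
    (w : Fin nW) → SW.Full x w → ¬ (∀ e → wend e ≡ w → x' e ≡ x e) →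
    (Σ ℕ (λ i → SW.IsCrit x w i × SW.IsCrit x' w i)) ×
    (∀ e → SW.InHead x' w e ⇔ SW.InHead x w e) ×
    (∀ e → SW.InHead x w e ⇔ ((wend e ≡ w) × (x' e < x e)))
lemma3 I x (x-asg , _) ε _ ε<x _ gap x' x'-stable (x⪰x' , _) Σdist≡ε w x-full x'≢x =
  (c , crit , crit') ,
  (λ e → mk⇔ (head'⇒head crit crit' head-h) (decreased⇒head' crit crit' ∘ head⇒decreased crit crit' dec₀)) ,
  (λ e → mk⇔ (head⇒decreased crit crit' dec₀) (head'⇒head crit crit' head-h ∘ decreased⇒head' crit crit'))
  where
  open Instance I
  open MarketProperties I
  open Decrease x-asg x'-stable x⪰x'
  open AtFullWorker x-full
  open Perturbation ε<x (gap w x-full) Σdist≡ε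
  e₀ = proj₁ (decreased-edge x'≢x)
  dec₀ : Decreased e₀
  dec₀ = proj₂ (decreased-edge x'≢x)
  c = proj₁ (WP.IsCrit-exists x-full (qW-pos w))
  crit = proj₂ (WP.IsCrit-exists x-full (qW-pos w))
  crit' = crit-preserved crit dec₀
  head-h = proj₂ (WP.head-exists x-full crit (proj₁ dec₀) (decreased⇒rank≡crit crit crit' dec₀))
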